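{- Let $m\geq1$ and $n\geq 2m+1$ be integers, write $n=c(2m+1)+r$ with $0\le r<2m+1$, let $\mu=\gcd(2m+1,r)$ and $l_2=(2m+1)/\mu$, and for $i\in\{1,\dots,\mu\}$ let $S_i=[i]_\mu\cap[1,n]$, viewed as a set of vertices of the web graph $W_n^m$ by identifying $j\in[1,n]$ with the vertex $v_{m+j}$ (index modulo $n$ in $\{1,\dots,n\}$). Then for every vertex $v$ of $W_n^m$ and every $i\in\{1,\dots,\mu\}$, $|N[v]\cap S_i|=l_2$.
   Context: Web graph: $W_n^m$ has vertex set $\{v_1,\dots,v_n\}$ and $v_iv_j$ is an edge iff $j\equiv i\pm l\pmod n$ for some $l\in\{1,\dots,m\}$. $N[v]$ denotes the closed neighborhood of $v$ in $W_n^m$; under the identification, $N[j]=\{j-m,\dots,j+m\}$ taken modulo $n$. $[i]_\mu$ is the congruence class of $i$ modulo $\mu$; $\gcd(a,0)=a$. -}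

module Defs where

open import Data.Nat using (ℕ; zero; suc; _+_; _*_; _%_; _/_; _≡ᵇ_)
open import Data.Nat.GCD using (gcd)
open import Data.Bool using (Bool; _∧_; _∨_)
open import Data.Fin using (Fin; toℕ)
open import Data.Bool.ListAction using (any)
open import Data.List using (List; map; upTo; filterᵇ; length; allFin)

-- a mod b and a div b, total versions (for b = 0 they are never used below,
-- since n ≥ 2m+1 ≥ 3 and μ = gcd(2m+1, r) ≥ 1)
_mod_ : ℕ → ℕ → ℕ
a mod zero = a
a mod suc k = a % suc k

_div_ : ℕ → ℕ → ℕ
a div zero = zero
a div suc k = a / suc k

-- Vertices of W_n^m: Fin n, where t : Fin n stands for v_{t+1}.
-- Closed neighbourhood membership: u ∈ N[v] iff u ≡ v ± l (mod n) for some
-- l ∈ {0,…,m}  (l = 0 gives u = v, l ∈ {1,…,m} gives the web-graph edges).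
inN : (n m : ℕ) → Fin n → Fin n → Bool
inN n m v u =
  any (λ l → (((toℕ v + l) mod n) ≡ᵇ toℕ u) ∨ (((toℕ u + l) mod n) ≡ᵇ toℕ v))
      (upTo (suc m))

inS : (n m μ i : ℕ) → Fin n → Bool
inS n m μ i t =
  any (λ j → ((j mod μ) ≡ᵇ (i mod μ)) ∧ (((m + j) mod n) ≡ᵇ (suc (toℕ t) mod n)))
      (map suc (upTo n))

cardNS : (n m μ i : ℕ) → Fin n → ℕ
cardNS n m μ i v = length (filterᵇ (λ u → inN n m v u ∧ inS n m μ i u) (allFin n))

webμ : (n m : ℕ) → ℕ
webμ n m = gcd (suc (2 * m)) (n mod suc (2 * m))

webl₂ : (n m : ℕ) → ℕ
webl₂ n m = suc (2 * m) div webμ n m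

{-# OPTIONS --safe #-}
module Submission where

-- Index the vertices u by their offset d from v - m, i.e. u = v - m + d (mod n). Since 2m < n,
-- u ∈ N[v] exactly when d ≤ 2m. Since μ divides n, membership of u in S_i depends only on
-- d mod μ, and it holds for exactly one residue class. As μ also divides 2m + 1, exactly
-- (2m + 1)/μ of the offsets 0, …, 2m lie in that class.

open import Defs
open import Data.Bool using (Bool; true; false; if_then_else_; _∧_; _∨_; T)
open import Data.Bool.Properties using (T-≡; T-∧; T-∨)
open import Data.Bool.ListAction using (any)
open import Data.Empty using (⊥-elim)
open import Data.Fin as Fin using (Fin; toℕ)
open import Data.Fin.Properties using (toℕ<n)
open import Data.List using (upTo; map; filterᵇ; length; tabulate)
open import Data.List.Membership.Propositional using (find; lose)
open import Data.List.Membership.Propositional.Properties using (∈-upTo⁺; ∈-upTo⁻; ∈-map⁺)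
open import Data.List.Relation.Unary.Any.Properties using (any⁺; any⁻)
open import Data.Nat
open import Data.Nat.Properties
open import Data.Nat.DivMod hiding (_div_; _mod_)
open import Data.Nat.Divisibility using (_∣_; ∣-refl; ∣-trans; n∣m*n; ∣m∣n⇒∣m+n; 0∣⇒≡0)
open import Data.Nat.GCD using (gcd[m,n]∣m; gcd[m,n]∣n)
open import Data.Nat.Tactic.RingSolver using (solve-∀)
open import Data.Product using (Σ; _×_; _,_)
open import Data.Sum as Sum using (_⊎_; inj₁; inj₂)
open import Function using (_∘_; id; flip; _⇔_; mk⇔; Equivalence)
open import Relation.Nullary using (yes; no)
open import Relation.Binary.PropositionalEquality

count : (ℕ → Bool) → ℕ → ℕ
count f zero    = 0
count f (suc n) = (if f 0 then 1 else 0) + count (f ∘ suc) n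

count-cong : ∀ {f g} n → (∀ k → k < n → f k ≡ g k) → count f n ≡ count g n
count-cong zero    f≗g = refl
count-cong (suc n) f≗g =
  cong₂ (λ b c → (if b then 1 else 0) + c) (f≗g 0 z<s) (count-cong n (λ k → f≗g (suc k) ∘ s<s))

count-+ : ∀ f a b → count f (a + b) ≡ count f a + count (λ k → f (a + k)) b
count-+ f zero    b = refl
count-+ f (suc a) b =
  trans (cong (b₀ +_) (count-+ (f ∘ suc) a b)) (sym (+-assoc b₀ (count (f ∘ suc) a) _))
  where b₀ = if f 0 then 1 else 0

count-false : ∀ n → count (λ _ → false) n ≡ 0
count-false zero    = refl
count-false (suc n) = count-false n

count-≡ᵇ : ∀ {z n} → z < n → count (_≡ᵇ z) n ≡ 1
count-≡ᵇ {zero}  {suc n} _         = cong suc (count-false n)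
count-≡ᵇ {suc z} {suc n} (s<s z<n) = count-≡ᵇ z<n

count-periodic : ∀ g p L → (∀ k → g (p + k) ≡ g k) → count g (L * p) ≡ L * count g p
count-periodic g p zero    g-per = refl
count-periodic g p (suc L) g-per = begin
  count g (p + L * p)                         ≡⟨ count-+ g p (L * p) ⟩
  count g p + count (λ k → g (p + k)) (L * p) ≡⟨ cong (count g p +_) (count-cong (L * p) (λ k _ → g-per k)) ⟩
  count g p + count g (L * p)                 ≡⟨ cong (count g p +_) (count-periodic g p L g-per) ⟩
  count g p + L * count g p                   ∎
  where open ≡-Reasoning

count-prefix : ∀ g k N → suc k ≤ N → count (λ d → (d ≤ᵇ k) ∧ g d) N ≡ count g (suc k)
count-prefix g k N k<N = begin
  count h N                                          ≡⟨ cong (count h) (sym (m+[n∸m]≡n k<N)) ⟩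
  count h (suc k + (N ∸ suc k))                      ≡⟨ count-+ h (suc k) (N ∸ suc k) ⟩
  count h (suc k) + count (λ e → h (suc k + e)) (N ∸ suc k)
    ≡⟨ cong₂ _+_ (count-cong (suc k) inside) (count-cong (N ∸ suc k) (λ e _ → outside e)) ⟩
  count g (suc k) + count (λ _ → false) (N ∸ suc k)  ≡⟨ cong (count g (suc k) +_) (count-false (N ∸ suc k)) ⟩
  count g (suc k) + 0                                ≡⟨ +-identityʳ _ ⟩
  count g (suc k)                                    ∎
  where
  open ≡-Reasoning
  h : ℕ → Bool
  h d = (d ≤ᵇ k) ∧ g d
  inside : ∀ d → d < suc k → h d ≡ g d
  inside d (s≤s d≤k) rewrite Equivalence.to T-≡ (≤⇒≤ᵇ d≤k) = refl
  outside : ∀ e → h (suc k + e) ≡ false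
  outside e with suc k + e ≤ᵇ k in eq
  ... | false = refl
  ... | true  = ⊥-elim (<⇒≱ (m≤m+n (suc k) e) (≤ᵇ⇒≤ _ k (subst T (sym eq) _)))

count-rotate-< : ∀ h N .{{_ : NonZero N}} a → a < N → count (λ k → h ((k + a) % N)) N ≡ count h N
count-rotate-< h N a a<N = begin
  count F N                               ≡⟨ cong (count F) (sym b+a≡N) ⟩
  count F (b + a)                         ≡⟨ count-+ F b a ⟩
  count F b + count (λ k → F (b + k)) a   ≡⟨ cong₂ _+_ (count-cong b head) (count-cong a tail) ⟩
  count (λ k → h (a + k)) b + count h a   ≡⟨ +-comm _ (count h a) ⟩
  count h a + count (λ k → h (a + k)) b   ≡⟨ sym (count-+ h a b) ⟩
  count h (a + b)                         ≡⟨ cong (count h) (m+[n∸m]≡n (<⇒≤ a<N)) ⟩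
  count h N                               ∎
  where
  open ≡-Reasoning
  F : ℕ → Bool
  F k = h ((k + a) % N)
  b = N ∸ a
  b+a≡N : b + a ≡ N
  b+a≡N = m∸n+n≡m (<⇒≤ a<N)
  head : ∀ k → k < b → F k ≡ h (a + k)
  head k k<b = cong h (trans (m<n⇒m%n≡m (subst (k + a <_) b+a≡N (+-monoˡ-< a k<b))) (+-comm k a))
  tail : ∀ k → k < a → F (b + k) ≡ h k
  tail k k<a = cong h (begin
    (b + k + a) % N   ≡⟨ cong (_% N) (trans (+-assoc b k a) (trans (cong (b +_) (+-comm k a)) (sym (+-assoc b a k)))) ⟩
    (b + a + k) % N   ≡⟨ cong (λ x → (x + k) % N) b+a≡N ⟩
    (N + k) % N       ≡⟨ %-remove-+ˡ k ∣-refl ⟩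
    k % N             ≡⟨ m<n⇒m%n≡m (<-trans k<a a<N) ⟩
    k                 ∎)

count-rotate : ∀ h N .{{_ : NonZero N}} a → count (λ k → h ((k + a) % N)) N ≡ count h N
count-rotate h N a =
  trans (count-cong N (λ k _ → cong h (reduce k))) (count-rotate-< h N (a % N) (m%n<n a N))
  where
  reduce : ∀ k → (k + a) % N ≡ (k + a % N) % N
  reduce k = begin
    (k + a) % N              ≡⟨ %-distribˡ-+ k a N ⟩
    (k % N + a % N) % N      ≡⟨ cong (λ x → (k % N + x) % N) (sym (m%n%n≡m%n a N)) ⟩
    (k % N + a % N % N) % N  ≡⟨ sym (%-distribˡ-+ k (a % N) N) ⟩
    (k + a % N) % N          ∎
    where open ≡-Reasoning

count-residues : ∀ μ .{{_ : NonZero μ}} K a {z} → μ ∣ K → z < μ →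
  count (λ d → (d + a) % μ ≡ᵇ z) K ≡ K / μ
count-residues μ K a {z} μ∣K z<μ = begin
  count g K              ≡⟨ cong (count g) (sym (m/n*n≡m μ∣K)) ⟩
  count g (K / μ * μ)    ≡⟨ count-periodic g μ (K / μ) period ⟩
  K / μ * count g μ      ≡⟨ cong (K / μ *_) (trans (count-rotate (_≡ᵇ z) μ a) (count-≡ᵇ z<μ)) ⟩
  K / μ * 1              ≡⟨ *-identityʳ (K / μ) ⟩
  K / μ                  ∎
  where
  open ≡-Reasoning
  g : ℕ → Bool
  g d = (d + a) % μ ≡ᵇ z
  period : ∀ k → g (μ + k) ≡ g k
  period k = cong (_≡ᵇ z) (trans (cong (_% μ) (+-assoc μ k a)) (%-remove-+ˡ (k + a) ∣-refl))

length-filterᵇ-tabulate : ∀ {A : Set} n (g : Fin n → A) (P : A → Bool) (f : ℕ → Bool) →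
  (∀ i → P (g i) ≡ f (toℕ i)) → length (filterᵇ P (tabulate g)) ≡ count f n
length-filterᵇ-tabulate zero    g P f P≗f = refl
length-filterᵇ-tabulate (suc n) g P f P≗f with P (g Fin.zero) | P≗f Fin.zero
... | true  | eq rewrite sym eq = cong suc (length-filterᵇ-tabulate n _ P _ (P≗f ∘ Fin.suc))
... | false | eq rewrite sym eq = length-filterᵇ-tabulate n _ P _ (P≗f ∘ Fin.suc)

module _ {n : ℕ} where
  private
    N = suc n

  %-+-congʳ : ∀ a b c → a % N ≡ b % N → (a + c) % N ≡ (b + c) % N
  %-+-congʳ a b c a≡b = begin
    (a + c) % N            ≡⟨ %-distribˡ-+ a c N ⟩
    (a % N + c % N) % N    ≡⟨ cong (λ x → (x + c % N) % N) a≡b ⟩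
    (b % N + c % N) % N    ≡⟨ sym (%-distribˡ-+ b c N) ⟩
    (b + c) % N            ∎
    where open ≡-Reasoning

  -- Adding n * c to a + c gives a + c * N, so c can be removed again.
  %-+-cancelʳ : ∀ a b c → (a + c) % N ≡ (b + c) % N → a % N ≡ b % N
  %-+-cancelʳ a b c a+c≡b+c = begin
    a % N                  ≡⟨ sym ([m+kn]%n≡m%n a c N) ⟩
    (a + c * N) % N        ≡⟨ cong (_% N) (rearrange a c n) ⟩
    (a + c + n * c) % N    ≡⟨ %-+-congʳ (a + c) (b + c) (n * c) a+c≡b+c ⟩
    (b + c + n * c) % N    ≡⟨ cong (_% N) (sym (rearrange b c n)) ⟩
    (b + c * N) % N        ≡⟨ [m+kn]%n≡m%n b c N ⟩
    b % N                  ∎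
    where
    open ≡-Reasoning
    rearrange : ∀ x c n → x + c * suc n ≡ x + c + n * c
    rearrange = solve-∀

  %≡%⇒≡ : ∀ {a b} → b < N → a < b + N → a % N ≡ b % N → a ≡ b
  %≡%⇒≡ {a} {b} b<N a<b+N a≡b = by-quotient (a / N) refl
    where
    a≡b+qN : a ≡ b + a / N * N
    a≡b+qN = trans (m≡m%n+[m/n]*n a N) (cong (_+ a / N * N) (trans a≡b (m<n⇒m%n≡m b<N)))
    by-quotient : ∀ q → a / N ≡ q → a ≡ b
    by-quotient zero    q≡0 = trans a≡b+qN (trans (cong (λ q → b + q * N) q≡0) (+-identityʳ b))
    by-quotient (suc q) q≡1+q = ⊥-elim (<⇒≱ a<b+N (begin
      b + N              ≤⟨ m≤m+n (b + N) (q * N) ⟩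
      b + N + q * N      ≡⟨ +-assoc b N (q * N) ⟩
      b + suc q * N      ≡⟨ cong (λ q → b + q * N) (sym q≡1+q) ⟩
      b + a / N * N      ≡⟨ sym a≡b+qN ⟩
      a                  ∎))
      where open ≤-Reasoning

%≡%-∣ : ∀ {k n} a b → suc k ∣ suc n → a % suc n ≡ b % suc n → a % suc k ≡ b % suc k
%≡%-∣ {k} {n} a b μ∣N a≡b =
  trans (sym (m∣n⇒o%n%m≡o%m (suc k) (suc n) a μ∣N))
        (trans (cong (_% suc k) a≡b) (m∣n⇒o%n%m≡o%m (suc k) (suc n) b μ∣N))

inNᵇ : ℕ → ℕ → ℕ → ℕ → Bool
inNᵇ n m x y = any (λ l → (((x + l) mod n) ≡ᵇ y) ∨ (((y + l) mod n) ≡ᵇ x)) (upTo (suc m))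

inSᵇ : ℕ → ℕ → ℕ → ℕ → ℕ → Bool
inSᵇ n m μ i y =
  any (λ j → ((j mod μ) ≡ᵇ (i mod μ)) ∧ (((m + j) mod n) ≡ᵇ (suc y mod n))) (map suc (upTo n))

T-injective : ∀ {a b} → T a ⇔ T b → a ≡ b
T-injective {false} {false} _ = refl
T-injective {false} {true}  a⇔b = ⊥-elim (Equivalence.from a⇔b _)
T-injective {true}  {false} a⇔b = ⊥-elim (Equivalence.to a⇔b _)
T-injective {true}  {true}  _ = refl

-- The hypothesis on t + m says t = v - m + d on the n-cycle.
module CycleOffset {n m v t d : ℕ} (m+m<N : m + m < suc n) (v<N : v < suc n) (t<N : t < suc n)
                   (d<N : d < suc n) (t+m≡d+v : (t + m) % suc n ≡ (d + v) % suc n) where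
  private
    N = suc n
    rearrange : ∀ a b c → a + b + c ≡ c + a + b
    rearrange = solve-∀

  close⇒offset : ∀ {l} → l ≤ m → (v + l) % N ≡ t ⊎ (t + l) % N ≡ v → d ≤ m + m
  close⇒offset {l} l≤m (inj₁ v+l≡t) = subst (_≤ m + m) l+m≡d (+-monoˡ-≤ m l≤m)
    where
    open ≡-Reasoning
    l+m≡d : l + m ≡ d
    l+m≡d = %≡%⇒≡ d<N (<-≤-trans (≤-<-trans (+-monoˡ-≤ m l≤m) m+m<N) (m≤n+m N d))
      (%-+-cancelʳ (l + m) d v (begin
        (l + m + v) % N   ≡⟨ cong (_% N) (rearrange l m v) ⟩
        (v + l + m) % N   ≡⟨ %-+-congʳ (v + l) t m (trans v+l≡t (sym (m<n⇒m%n≡m t<N))) ⟩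
        (t + m) % N       ≡⟨ t+m≡d+v ⟩
        (d + v) % N       ∎))
  close⇒offset {l} l≤m (inj₂ t+l≡v) = ≤-trans (subst (d ≤_) l+d≡m (m≤n+m d l)) (m≤m+n m m)
    where
    open ≡-Reasoning
    l+d≡m : l + d ≡ m
    l+d≡m = %≡%⇒≡ (≤-<-trans (m≤m+n m m) m+m<N) (+-mono-≤-< l≤m d<N)
      (%-+-cancelʳ (l + d) m t (begin
        (l + d + t) % N   ≡⟨ cong (_% N) (rearrange l d t) ⟩
        (t + l + d) % N   ≡⟨ %-+-congʳ (t + l) v d (trans t+l≡v (sym (m<n⇒m%n≡m v<N))) ⟩
        (v + d) % N       ≡⟨ cong (_% N) (+-comm v d) ⟩
        (d + v) % N       ≡⟨ sym t+m≡d+v ⟩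
        (t + m) % N       ≡⟨ cong (_% N) (+-comm t m) ⟩
        (m + t) % N       ∎))

  offset⇒close : d ≤ m + m → Σ ℕ λ l → l ≤ m × ((v + l) % N ≡ t ⊎ (t + l) % N ≡ v)
  offset⇒close d≤m+m with m ≤? d
  ... | yes m≤d = d ∸ m , m≤n+o⇒m∸n≤o d m d≤m+m ,
    inj₁ (flip trans (m<n⇒m%n≡m t<N) (%-+-cancelʳ (v + (d ∸ m)) t m (begin
        (v + (d ∸ m) + m) % N   ≡⟨ cong (_% N) (trans (+-assoc v (d ∸ m) m) (cong (v +_) (m∸n+n≡m m≤d))) ⟩
        (v + d) % N             ≡⟨ cong (_% N) (+-comm v d) ⟩
        (d + v) % N             ≡⟨ sym t+m≡d+v ⟩
        (t + m) % N             ∎)))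
    where open ≡-Reasoning
  ... | no m≰d = m ∸ d , m∸n≤m m d ,
    inj₂ (flip trans (m<n⇒m%n≡m v<N) (%-+-cancelʳ (t + (m ∸ d)) v d (begin
        (t + (m ∸ d) + d) % N   ≡⟨ cong (_% N) (trans (+-assoc t (m ∸ d) d) (cong (t +_) (m∸n+n≡m d≤m))) ⟩
        (t + m) % N             ≡⟨ t+m≡d+v ⟩
        (d + v) % N             ≡⟨ cong (_% N) (+-comm d v) ⟩
        (v + d) % N             ∎)))
    where
    open ≡-Reasoning
    d≤m = <⇒≤ (≰⇒> m≰d)

inNᵇ-offset : ∀ {n m v t d} → m + m < suc n → v < suc n → t < suc n → d < suc n →
  (t + m) % suc n ≡ (d + v) % suc n → inNᵇ (suc n) m v t ≡ (d ≤ᵇ m + m)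
inNᵇ-offset {n} {m} {v} {t} {d} m+m<N v<N t<N d<N t+m≡d+v = T-injective (mk⇔ to from)
  where
  open CycleOffset m+m<N v<N t<N d<N t+m≡d+v
  to : T (inNᵇ (suc n) m v t) → T (d ≤ᵇ m + m)
  to close with find (any⁻ _ (upTo (suc m)) close)
  ... | l , l∈ , p = ≤⇒≤ᵇ (close⇒offset (s≤s⁻¹ (∈-upTo⁻ l∈))
                      (Sum.map (≡ᵇ⇒≡ _ _) (≡ᵇ⇒≡ _ _) (Equivalence.to T-∨ p)))
  from : T (d ≤ᵇ m + m) → T (inNᵇ (suc n) m v t)
  from d≤m+m with offset⇒close (≤ᵇ⇒≤ d (m + m) d≤m+m)
  ... | l , l≤m , p = any⁺ _ (lose (∈-upTo⁺ (s≤s l≤m))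
                        (Equivalence.from T-∨ (Sum.map (≡⇒≡ᵇ _ _) (≡⇒≡ᵇ _ _) p)))

inSᵇ-class : ∀ {n k} m i t → suc k ∣ suc n →
  inSᵇ (suc n) m (suc k) i t ≡ (suc t % suc k ≡ᵇ (i + m) % suc k)
inSᵇ-class {n} {k} m i t μ∣N = T-injective (mk⇔ to from)
  where
  N = suc n
  μ = suc k
  to : T (inSᵇ N m μ i t) → T (suc t % μ ≡ᵇ (i + m) % μ)
  to inS with find (any⁻ _ (map suc (upTo N)) inS)
  ... | j , _ , p with Equivalence.to T-∧ p
  ... | j≡i , m+j≡1+t = ≡⇒≡ᵇ _ _ (begin
    suc t % μ    ≡⟨ sym (%≡%-∣ (m + j) (suc t) μ∣N (≡ᵇ⇒≡ _ _ m+j≡1+t)) ⟩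
    (m + j) % μ  ≡⟨ cong (_% μ) (+-comm m j) ⟩
    (j + m) % μ  ≡⟨ %-+-congʳ j i m (≡ᵇ⇒≡ _ _ j≡i) ⟩
    (i + m) % μ  ∎)
    where open ≡-Reasoning
  from : T (suc t % μ ≡ᵇ (i + m) % μ) → T (inSᵇ N m μ i t)
  from 1+t≡i+m = any⁺ _ (lose (∈-map⁺ suc (∈-upTo⁺ (m%n<n (t + n * m) N)))
                             (Equivalence.from T-∧ (≡⇒≡ᵇ _ _ j≡i , ≡⇒≡ᵇ _ _ m+j≡1+t)))
    where
    open ≡-Reasoning
    x = (t + n * m) % N
    j = suc x
    rearrange₁ : ∀ m x → m + suc x ≡ x + suc m
    rearrange₁ = solve-∀
    rearrange₂ : ∀ t n m → t + n * m + suc m ≡ suc t + m * suc n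
    rearrange₂ = solve-∀
    m+j≡1+t : (m + j) % N ≡ suc t % N
    m+j≡1+t = begin
      (m + j) % N                ≡⟨ cong (_% N) (rearrange₁ m x) ⟩
      (x + suc m) % N            ≡⟨ %-+-congʳ x (t + n * m) (suc m) (m%n%n≡m%n (t + n * m) N) ⟩
      (t + n * m + suc m) % N    ≡⟨ cong (_% N) (rearrange₂ t n m) ⟩
      (suc t + m * N) % N        ≡⟨ [m+kn]%n≡m%n (suc t) m N ⟩
      suc t % N                  ∎
    j≡i : j % μ ≡ i % μ
    j≡i = %-+-cancelʳ j i m (begin
      (j + m) % μ   ≡⟨ cong (_% μ) (+-comm j m) ⟩
      (m + j) % μ   ≡⟨ %≡%-∣ (m + j) (suc t) μ∣N m+j≡1+t ⟩
      suc t % μ     ≡⟨ ≡ᵇ⇒≡ _ _ 1+t≡i+m ⟩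
      (i + m) % μ   ∎)

cardNS≡[1+2m]/μ : ∀ m n k (v : Fin (suc n)) i → suc (2 * m) ≤ suc n → suc k ∣ suc (2 * m) → suc k ∣ suc n →
  cardNS (suc n) m (suc k) i v ≡ suc (2 * m) / suc k
cardNS≡[1+2m]/μ m n k v i 2m+1≤N μ∣2m+1 μ∣N = begin
  cardNS N m μ i v                    ≡⟨ length-filterᵇ-tabulate N id _ f (λ _ → refl) ⟩
  count f N                           ≡⟨ sym (count-rotate f N s) ⟩
  count (λ d → f ((d + s) % N)) N     ≡⟨ count-cong N shifted ⟩
  count (λ d → (d ≤ᵇ m + m) ∧ g d) N  ≡⟨ count-prefix g (m + m) N m+m<N ⟩
  count g (suc (m + m))               ≡⟨ cong (count g) (sym 1+2m≡1+m+m) ⟩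
  count g (suc (2 * m))               ≡⟨ count-residues μ (suc (2 * m)) (suc s) μ∣2m+1 (m%n<n (i + m) μ) ⟩
  suc (2 * m) / μ                     ∎
  where
  open ≡-Reasoning
  N = suc n
  μ = suc k
  -- s ≡ v - m (mod N)
  s = toℕ v + n * m
  f : ℕ → Bool
  f u = inNᵇ N m (toℕ v) u ∧ inSᵇ N m μ i u
  g : ℕ → Bool
  g d = (d + suc s) % μ ≡ᵇ (i + m) % μ
  1+2m≡1+m+m : suc (2 * m) ≡ suc (m + m)
  1+2m≡1+m+m = cong (λ x → suc (m + x)) (+-identityʳ m)
  m+m<N : m + m < N
  m+m<N = subst (_≤ N) 1+2m≡1+m+m 2m+1≤N
  rearrange : ∀ d v m n → d + (v + n * m) + m ≡ d + v + m * suc n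
  rearrange = solve-∀
  shifted : ∀ d → d < N → f ((d + s) % N) ≡ (d ≤ᵇ m + m) ∧ g d
  shifted d d<N = cong₂ _∧_
    (inNᵇ-offset m+m<N (toℕ<n v) (m%n<n (d + s) N) d<N t+m≡d+v)
    (trans (inSᵇ-class m i t μ∣N) (cong (_≡ᵇ (i + m) % μ) 1+t≡d+1+s))
    where
    t = (d + s) % N
    t+m≡d+v : (t + m) % N ≡ (d + toℕ v) % N
    t+m≡d+v = begin
      (t + m) % N                    ≡⟨ %-+-congʳ t (d + s) m (m%n%n≡m%n (d + s) N) ⟩
      (d + s + m) % N                ≡⟨ cong (_% N) (rearrange d (toℕ v) m n) ⟩
      (d + toℕ v + m * N) % N        ≡⟨ [m+kn]%n≡m%n (d + toℕ v) m N ⟩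
      (d + toℕ v) % N                ∎
    1+t≡d+1+s : suc t % μ ≡ (d + suc s) % μ
    1+t≡d+1+s = %≡%-∣ (suc t) (d + suc s) μ∣N (begin
      suc t % N          ≡⟨ cong (_% N) (+-comm 1 t) ⟩
      (t + 1) % N        ≡⟨ %-+-congʳ t (d + s) 1 (m%n%n≡m%n (d + s) N) ⟩
      (d + s + 1) % N    ≡⟨ cong (_% N) (trans (+-assoc d s 1) (cong (d +_) (+-comm s 1))) ⟩
      (d + suc s) % N    ∎)

lemma6p1 : (m n : ℕ) → 1 ≤ m → suc (2 * m) ≤ n →
    (v : Fin n) → (i : ℕ) → 1 ≤ i → i ≤ webμ n m →
    cardNS n m (webμ n m) i v ≡ webl₂ n m
lemma6p1 m zero    _ ()      v i _ _
lemma6p1 m (suc n) _ 2m+1≤n v i _ _ = by-μ (webμ (suc n) m) μ∣K μ∣n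
  where
  K = suc (2 * m)
  μ∣K : webμ (suc n) m ∣ K
  μ∣K = gcd[m,n]∣m K (suc n % K)
  μ∣n : webμ (suc n) m ∣ suc n
  μ∣n = subst (webμ (suc n) m ∣_) (sym (m≡m%n+[m/n]*n (suc n) K))
          (∣m∣n⇒∣m+n (gcd[m,n]∣n K (suc n % K)) (∣-trans μ∣K (n∣m*n (suc n / K))))
  by-μ : ∀ μ → μ ∣ K → μ ∣ suc n → cardNS (suc n) m μ i v ≡ K div μ
  by-μ zero    0∣K _ with () ← 0∣⇒≡0 0∣K
  by-μ (suc k) = cardNS≡[1+2m]/μ m n k v i 2m+1≤n
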